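{- For every $n\geq 1$, the map $\eta$ is a bijection from the set $\mathcal{A}_n$ of ascent sequences of length $n$ onto the set $\hat{\mathcal{B}}_{n+1}$ of revised ascent sequences of length $n+1$. In particular $|\hat{\mathcal{B}}_{n+1}|=|\mathcal{A}_n|$ is the $n$-th Fishburn number.
   Context: An endofunction of size $n$ is a word $x=x_1x_2\cdots x_n$ with $x_i\in[n]=\{1,\dots,n\}$. For such $x$, let $\mathrm{Asctop}(x)=\{1\}\cup\{i: 2\leq i\leq n,\ x_{i-1}<x_i\}$ and $\mathrm{Ascbot}(x)=\{1\}\cup\{i: 1\leq i\leq n-1,\ x_i<x_{i+1}\}$ (the index $1$ is always included), and let $\mathrm{asctop}(x)=|\mathrm{Asctop}(x)|$. An ascent sequence is an endofunction $x$ with $x_1=1$ and $1\leq x_i\leq \mathrm{asctop}(x_1\cdots x_{i-1})+1$ for all $2\leq i\leq n$; $\mathcal{A}_n$ is the set of ascent sequences of length $n$. A Cayley permutation is an endofunction $x$ containing every integer between $1$ and $\max(x)$; $\mathrm{Cay}_n$ is the set of these of length $n$. Let $\mathrm{Nub}(x)=\{\min x^{ -1}(i): i\in \mathrm{Im}(x)\}$ be the set of indices of leftmost copies of values. The set of revised ascent sequences of length $n$ is $\hat{\mathcal{B}}_n=\{x\in\mathrm{Cay}_n : \mathrm{Ascbot}(x)=\mathrm{Nub}(x)\}$. The map $\eta$: given an ascent sequence $x$ with $\mathrm{Ascbot}(x)=\{a_1<a_2<\cdots<a_k\}$, for $i=a_1,a_2,\dots,a_k$ in this order, and for each $j=1,\dots,i-1$,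 if (the current value) $x_j\geq x_i$ then replace $x_j$ by $x_j+1$. Let $\tilde{x}$ be the resulting sequence; then $\eta(x)$ is the sequence of length $n+1$ obtained by prepending $\max(\tilde{x})$ to $\tilde{x}$. (For example $\eta(12132124)=545354124$.) The Fishburn numbers $1,2,5,15,53,\dots$ have generating function $\sum_{n\geq1}\prod_{i=1}^n(1-(1-x)^i)$. -}

module Defs where

open import Data.Nat using (ℕ; zero; suc; _+_; _∸_; _≤_; _<_; _⊔_; _≤ᵇ_; _<ᵇ_; _≡ᵇ_)
open import Data.Bool using (Bool; true; false; _∨_; _∧_; if_then_else_; T)
open import Data.List using (List; []; _∷_; length; foldr; filter; applyUpTo; take)
open import Data.List.Membership.Propositional using (_∈_)
open import Data.Product using (_×_; Σ)
open import Data.Sum using (_⊎_)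
open import Relation.Binary.PropositionalEquality using (_≡_; _≢_)
open import Relation.Nullary using (¬_)
open import Relation.Nullary.Decidable using (T?)
open import Function.Bundles using (_⇔_)

-- Words are lists of naturals; positions are 1-based.
-- 'at x i' is x_i for 1 ≤ i ≤ length x (and 0 otherwise).
at : List ℕ → ℕ → ℕ
at []       _             = 0
at (a ∷ _)  (suc zero)    = a
at (_ ∷ xs) (suc (suc i)) = at xs (suc i)
at (_ ∷ _)  zero          = 0

maxW : List ℕ → ℕ
maxW = foldr _⊔_ 0

IsEndo : List ℕ → Set
IsEndo x = ∀ i → 1 ≤ i → i ≤ length x → (1 ≤ at x i) × (at x i ≤ length x)

ascCount : List ℕ → ℕ
ascCount []           = 0
ascCount (_ ∷ [])     = 0
ascCount (a ∷ b ∷ xs) = (if a <ᵇ b then 1 else 0) + ascCount (b ∷ xs)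

-- asctop(x) = |{1} ∪ {i : 2 ≤ i ≤ n, x_{i-1} < x_i}|
asctop : List ℕ → ℕ
asctop x = suc (ascCount x)

IsAscentSeq : List ℕ → Set
IsAscentSeq x =
  IsEndo x × (at x 1 ≡ 1) ×
  (∀ i → 2 ≤ i → i ≤ length x →
     (1 ≤ at x i) × (at x i ≤ asctop (take (i ∸ 1) x) + 1))

IsCayley : List ℕ → Set
IsCayley x = IsEndo x × (∀ v → 1 ≤ v → v ≤ maxW x → v ∈ x)

ascbotB : List ℕ → ℕ → Bool
ascbotB x i = (i ≡ᵇ 1) ∨ ((1 ≤ᵇ i) ∧ ((suc i ≤ᵇ length x) ∧ (at x i <ᵇ at x (suc i))))

InAscbot : List ℕ → ℕ → Set
InAscbot x i = T (ascbotB x i)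

InNub : List ℕ → ℕ → Set
InNub x i = (1 ≤ i) × (i ≤ length x) × (∀ j → 1 ≤ j → j < i → at x j ≢ at x i)

IsRevised : List ℕ → Set
IsRevised x = IsCayley x × (∀ i → InAscbot x i ⇔ InNub x i)

ascbotList : List ℕ → List ℕ
ascbotList x = filter (λ i → T? (ascbotB x i)) (applyUpTo suc (length x))

bumpFrom : ℕ → ℕ → ℕ → List ℕ → List ℕ
bumpFrom i v p []       = []
bumpFrom i v p (a ∷ xs) =
  (if (p <ᵇ i) ∧ (v ≤ᵇ a) then suc a else a) ∷ bumpFrom i v (suc p) xs

etaStep : ℕ → List ℕ → List ℕ
etaStep i xs = bumpFrom i (at xs i) 1 xs

etaSteps : List ℕ → List ℕ → List ℕ
etaSteps []       xs = xs
etaSteps (i ∷ is) xs = etaSteps is (etaStep i xs)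

η : List ℕ → List ℕ
η x = maxW x̃ ∷ x̃
  where x̃ = etaSteps (ascbotList x) x

{-# OPTIONS --safe #-}
module Submission where

-- Since η handles Ascbot(x) from left to right and the step at position i only
-- bumps letters before position i, x̃ can be computed letter by letter: if x ends
-- in b, then the x̃ of x a is x̃ followed by a, where, when b < a, every letter
-- ≥ b before the final b is bumped.  Ascbot = Nub is a local condition relating
-- each letter to its prefix and to the next letter, and it is invariant under
-- the order embedding "bump b".  Hence each letter preserves the invariant
-- "asctop x ∷ x̃ is revised and starts with its largest letter".  Conversely a
-- step can be undone: when b < a the letter b is new, so the earlier letters
-- can be unbumped.  This gives injectivity, and surjectivity by induction on the
-- length.

open import Defs

open import Data.Bool using (Bool; true; false; if_then_else_; T)
open import Data.Empty using (⊥)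
open import Data.List
  using (List; []; _∷_; _++_; _∷ʳ_; [_]; length; map; filter; applyUpTo; take; initLast; _∷ʳ′_)
open import Data.List.Membership.Propositional using (_∈_; _∉_)
open import Data.List.Membership.Propositional.Properties using (∈-map⁺; ∈-map⁻; ∈-++⁺ˡ; ∈-++⁺ʳ; ∈-++⁻)
open import Data.List.Properties
  using ( length-++; length-map; length-take; ++-assoc; ++-identityʳ; ∷ʳ-++; ∷-injective; ∷ʳ-injective
        ; map-injective; map-++; applyUpTo-∷ʳ; filter-++; take-all)
open import Data.List.Relation.Binary.Permutation.Propositional using (↭-sym)
open import Data.List.Relation.Binary.Permutation.Propositional.Properties using (∈-resp-↭; ∷↭∷ʳ)
open import Data.List.Relation.Unary.All as All using (All; []; _∷_)
import Data.List.Relation.Unary.All.Properties as Allₚ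
open import Data.List.Relation.Unary.Any using (here; there)
open import Data.List.Reverse using (Reverse; []; _∶_∶ʳ_; reverseView)
open import Data.Maybe using (Maybe; just; nothing)
open import Data.Nat using (ℕ; zero; suc; pred; >-nonZero; _+_; _∸_; _≤_; _<_; _≤ᵇ_; _<ᵇ_; z≤n; s≤s)
open import Data.Nat.Properties
open import Algebra.Properties.CommutativeSemigroup +-commutativeSemigroup using (x∙yz≈y∙xz)
open import Data.List.Membership.DecPropositional _≟_ using (_∈?_)
open import Data.Product using (_×_; _,_; proj₁; proj₂; ∃; Σ)
open import Data.Product.Function.NonDependent.Propositional using (_×-⇔_)
open import Data.Sum using (inj₁; inj₂)
open import Data.Unit using (⊤; tt)
open import Function.Base using (_∘_; id; case_of_)
open import Function.Bundles using (_⇔_; mk⇔; Equivalence)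
open import Function.Properties.Equivalence using () renaming (trans to ⇔-trans; sym to ⇔-sym)
open import Function.Related.TypeIsomorphisms using (¬-cong-⇔)
open import Relation.Binary.Definitions using (tri<; tri≈; tri>)
open import Relation.Binary.PropositionalEquality hiding ([_])
open import Relation.Nullary using (¬_; Dec; yes; no; contradiction)
open import Relation.Nullary.Decidable using (T?; dec-true; dec-false; decidable-stable)

open Equivalence using (to; from)

at-++ˡ : ∀ (s t : List ℕ) {i} → i ≤ length s → at (s ++ t) i ≡ at s i
at-++ˡ []          []      {zero}        _          = refl
at-++ˡ []          (_ ∷ _) {zero}        _          = refl
at-++ˡ (_ ∷ _)     _       {zero}        _          = refl
at-++ˡ (_ ∷ _)     _       {suc zero}    _          = refl
at-++ˡ (_ ∷ [])    _       {suc (suc _)} (s≤s ())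
at-++ˡ (_ ∷ y ∷ s) t       {suc (suc _)} (s≤s i≤∣s∣) = at-++ˡ (y ∷ s) t i≤∣s∣

at-middle : ∀ (s : List ℕ) c r → at (s ++ c ∷ r) (suc (length s)) ≡ c
at-middle []      c r = refl
at-middle (_ ∷ s) c r = at-middle s c r

at-next : ∀ (s : List ℕ) c d r → at (s ++ c ∷ d ∷ r) (suc (suc (length s))) ≡ d
at-next []      c d r = refl
at-next (_ ∷ s) c d r = at-next s c d r

at-∈ : ∀ (s : List ℕ) {i} → 1 ≤ i → i ≤ length s → at s i ∈ s
at-∈ (_ ∷ _)     {suc zero}    _ _            = here refl
at-∈ (_ ∷ [])    {suc (suc _)} _ (s≤s ())
at-∈ (_ ∷ y ∷ s) {suc (suc _)} _ (s≤s i≤∣ys∣) = there (at-∈ (y ∷ s) (s≤s z≤n) i≤∣ys∣)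

∈⇒at : ∀ {c} (s : List ℕ) → c ∈ s → ∃ λ i → 1 ≤ i × i ≤ length s × at s i ≡ c
∈⇒at (_ ∷ _)     (here refl)  = 1 , s≤s z≤n , s≤s z≤n , refl
∈⇒at (_ ∷ [])    (there ())
∈⇒at (_ ∷ y ∷ s) (there c∈ys) with ∈⇒at (y ∷ s) c∈ys
... | suc i , _ , i≤∣ys∣ , ysᵢ≡c = suc (suc i) , s≤s z≤n , s≤s i≤∣ys∣ , ysᵢ≡c

length-∷ʳ : ∀ (y : List ℕ) a → length (y ∷ʳ a) ≡ suc (length y)
length-∷ʳ []      a = refl
length-∷ʳ (_ ∷ y) a = cong suc (length-∷ʳ y a)

length-∷ʳ-∷ʳ : ∀ (p : List ℕ) b a → length (p ∷ʳ b ∷ʳ a) ≡ suc (suc (length p))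
length-∷ʳ-∷ʳ p b a = trans (length-∷ʳ (p ∷ʳ b) a) (cong suc (length-∷ʳ p b))

length-middle : ∀ (s : List ℕ) c r → length (s ++ c ∷ r) ≡ suc (length s + length r)
length-middle s c r = trans (length-++ s) (+-suc (length s) (length r))

1≤length-∷ʳ : ∀ (p : List ℕ) b → 1 ≤ length (p ∷ʳ b)
1≤length-∷ʳ p b = subst (1 ≤_) (sym (length-∷ʳ p b)) (s≤s z≤n)

[]≢∷ʳ : ∀ (q : List ℕ) b → [] ≢ q ∷ʳ b
[]≢∷ʳ []      b ()
[]≢∷ʳ (_ ∷ _) b ()

take-++ˡ : ∀ n (x y : List ℕ) → n ≤ length x → take n (x ++ y) ≡ take n x
take-++ˡ zero    x       y _          = refl
take-++ˡ (suc n) (c ∷ x) y (s≤s n≤∣x∣) = cong (c ∷_) (take-++ˡ n x y n≤∣x∣)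

length-take≤ : ∀ m (x : List ℕ) → length (take m x) ≤ m
length-take≤ m x = subst (_≤ m) (sym (length-take m x)) (m⊓n≤m m (length x))

maxW-ub : ∀ y {v} → v ∈ y → v ≤ maxW y
maxW-ub (a ∷ y) (here refl) = m≤m⊔n a (maxW y)
maxW-ub (a ∷ y) (there v∈y) = ≤-trans (maxW-ub y v∈y) (m≤n⊔m a (maxW y))

maxW-lub : ∀ y {M} → (∀ {v} → v ∈ y → v ≤ M) → maxW y ≤ M
maxW-lub []      _   = z≤n
maxW-lub (a ∷ y) y≤M = ⊔-lub (y≤M (here refl)) (maxW-lub y (y≤M ∘ there))

maxW-∈ : ∀ a y → maxW (a ∷ y) ∈ a ∷ y
maxW-∈ a []      = here (⊔-identityʳ a)
maxW-∈ a (b ∷ y) with ⊔-sel a (maxW (b ∷ y))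
... | inj₁ max≡a = here max≡a
... | inj₂ max≡m = there (subst (_∈ b ∷ y) (sym max≡m) (maxW-∈ b y))

-- Bumping

bump : ℕ → ℕ → ℕ
bump b v = if b ≤ᵇ v then suc v else v

bump-≥ : ∀ {b v} → b ≤ v → bump b v ≡ suc v
bump-≥ {b} {v} b≤v rewrite dec-true (b ≤? v) b≤v = refl

bump-< : ∀ {b v} → v < b → bump b v ≡ v
bump-< {b} {v} v<b rewrite dec-false (b ≤? v) (<⇒≱ v<b) = refl

bump-≤suc : ∀ b v → bump b v ≤ suc v
bump-≤suc b v with b ≤? v
... | yes b≤v rewrite bump-≥ b≤v = ≤-refl
... | no  b≰v rewrite bump-< (≰⇒> b≰v) = n≤1+n v

bump-inflationary : ∀ b v → v ≤ bump b v
bump-inflationary b v with b ≤? v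
... | yes b≤v rewrite bump-≥ b≤v = n≤1+n v
... | no  b≰v rewrite bump-< (≰⇒> b≰v) = ≤-refl

bump-strictMono : ∀ b {u v} → u < v → bump b u < bump b v
bump-strictMono b {u} {v} u<v with b ≤? u | b ≤? v
... | yes b≤u | yes b≤v rewrite bump-≥ b≤u | bump-≥ b≤v = s≤s u<v
... | yes b≤u | no  b≰v = contradiction (≤-trans b≤u (<⇒≤ u<v)) b≰v
... | no  b≰u | yes b≤v rewrite bump-< (≰⇒> b≰u) | bump-≥ b≤v = m≤n⇒m≤1+n u<v
... | no  b≰u | no  b≰v rewrite bump-< (≰⇒> b≰u) | bump-< (≰⇒> b≰v) = u<v

bump-≢ : ∀ b v → bump b v ≢ b
bump-≢ b v with b ≤? v
... | yes b≤v rewrite bump-≥ b≤v = λ v+1≡b → <⇒≱ (≤-reflexive v+1≡b) b≤v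
... | no  b≰v rewrite bump-< (≰⇒> b≰v) = λ v≡b → b≰v (≤-reflexive (sym v≡b))

b∉map-bump : ∀ b w → b ∉ map (bump b) w
b∉map-bump b w b∈ = let (c , _ , b≡bc) = ∈-map⁻ (bump b) b∈ in bump-≢ b c (sym b≡bc)

bump-cut : ∀ b c → c < b ⇔ bump b c < b
bump-cut b c = mk⇔ (λ c<b → subst (_< b) (sym (bump-< c<b)) c<b)
                   (≤-<-trans (bump-inflationary b c))

bump-bounds : ∀ {b M v} → 1 ≤ b → b ≤ suc M →
              (1 ≤ v × v ≤ M) ⇔ (1 ≤ bump b v × bump b v ≤ suc M)
bump-bounds {b} {M} {v} 1≤b b≤M+1 = mk⇔
  (λ (1≤v , v≤M) → ≤-trans 1≤v (bump-inflationary b v) , ≤-trans (bump-≤suc b v) (s≤s v≤M))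
  (λ (1≤bv , bv≤M+1) → lower v 1≤bv , upper bv≤M+1)
  where
  lower : ∀ v → 1 ≤ bump b v → 1 ≤ v
  lower (suc _) _    = s≤s z≤n
  lower zero    1≤b0 = subst (1 ≤_) (bump-< 1≤b) 1≤b0
  upper : bump b v ≤ suc M → v ≤ M
  upper bv≤M+1 with b ≤? v
  ... | yes b≤v = ≤-pred (subst (_≤ suc M) (bump-≥ b≤v) bv≤M+1)
  ... | no  b≰v = ≤-pred (≤-trans (≰⇒> b≰v) b≤M+1)

unbump : ℕ → ℕ → ℕ
unbump b v = if b <ᵇ v then pred v else v

unbump-suc : ∀ {b v} → b ≤ v → unbump b (suc v) ≡ v
unbump-suc {b} {v} b≤v rewrite dec-true (b <? suc v) (s≤s b≤v) = refl

bump-unbump : ∀ {b v} → v ≢ b → bump b (unbump b v) ≡ v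
bump-unbump {b} {v} v≢b with <-cmp v b
... | tri< v<b _ _ rewrite dec-false (b <? v) (<-asym v<b) = bump-< v<b
... | tri≈ _ v≡b _ = contradiction v≡b v≢b
... | tri> _ _ (s≤s b≤w) rewrite unbump-suc b≤w = bump-≥ b≤w

map-bump-unbump : ∀ b w → b ∉ w → map (bump b) (map (unbump b) w) ≡ w
map-bump-unbump b []      _   = refl
map-bump-unbump b (v ∷ w) b∉ =
  cong₂ _∷_ (bump-unbump (λ v≡b → b∉ (here (sym v≡b)))) (map-bump-unbump b w (b∉ ∘ there))

-- Computing η letter by letter

length-bumpFrom : ∀ i v p u → length (bumpFrom i v p u) ≡ length u
length-bumpFrom i v p []      = refl
length-bumpFrom i v p (_ ∷ u) = cong suc (length-bumpFrom i v (suc p) u)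

bumpFrom-++ : ∀ i v p (s t : List ℕ) →
              bumpFrom i v p (s ++ t) ≡ bumpFrom i v p s ++ bumpFrom i v (p + length s) t
bumpFrom-++ i v p []      t rewrite +-identityʳ p = refl
bumpFrom-++ i v p (a ∷ s) t rewrite +-suc p (length s) = cong (_ ∷_) (bumpFrom-++ i v (suc p) s t)

bumpFrom-before : ∀ i v p u → p + length u ≤ i → bumpFrom i v p u ≡ map (bump v) u
bumpFrom-before i v p []      _ = refl
bumpFrom-before i v p (a ∷ u) p+∣a∷u∣≤i
  with p+∣u∣<i ← subst (_≤ i) (+-suc p (length u)) p+∣a∷u∣≤i
  rewrite dec-true (p <? i) (≤-<-trans (m≤m+n p (length u)) p+∣u∣<i)
  = cong (bump v a ∷_) (bumpFrom-before i v (suc p) u p+∣u∣<i)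

bumpFrom-after : ∀ i v p u → i ≤ p → bumpFrom i v p u ≡ u
bumpFrom-after i v p []      _   = refl
bumpFrom-after i v p (a ∷ u) i≤p rewrite dec-false (p <? i) (≤⇒≯ i≤p) =
  cong (a ∷_) (bumpFrom-after i v (suc p) u (m≤n⇒m≤1+n i≤p))

etaStep-∷ʳ : ∀ i (y : List ℕ) a → i ≤ length y → etaStep i (y ∷ʳ a) ≡ etaStep i y ∷ʳ a
etaStep-∷ʳ i y a i≤∣y∣
  rewrite at-++ˡ y [ a ] i≤∣y∣
        | bumpFrom-++ i (at y i) 1 y [ a ]
        | bumpFrom-after i (at y i) (1 + length y) [ a ] (m≤n⇒m≤1+n i≤∣y∣) = refl

etaStep-last : ∀ (u : List ℕ) b → etaStep (suc (length u)) (u ∷ʳ b) ≡ map (bump b) u ∷ʳ b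
etaStep-last u b
  rewrite at-middle u b []
        | bumpFrom-++ (suc (length u)) b 1 u [ b ]
        | bumpFrom-before (suc (length u)) b 1 u ≤-refl
        | bumpFrom-after (suc (length u)) b (1 + length u) [ b ] ≤-refl = refl

length-etaSteps : ∀ L y → length (etaSteps L y) ≡ length y
length-etaSteps []      y = refl
length-etaSteps (i ∷ L) y =
  trans (length-etaSteps L (etaStep i y)) (length-bumpFrom i (at y i) 1 y)

etaSteps-∷ʳ : ∀ L (y : List ℕ) a → All (_≤ length y) L → etaSteps L (y ∷ʳ a) ≡ etaSteps L y ∷ʳ a
etaSteps-∷ʳ []      y a _ = refl
etaSteps-∷ʳ (i ∷ L) y a (i≤∣y∣ ∷ L≤∣y∣) rewrite etaStep-∷ʳ i y a i≤∣y∣ =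
  etaSteps-∷ʳ L (etaStep i y) a
    (subst (λ n → All (_≤ n) L) (sym (length-bumpFrom i (at y i) 1 y)) L≤∣y∣)

etaSteps-++ : ∀ L L′ y → etaSteps (L ++ L′) y ≡ etaSteps L′ (etaSteps L y)
etaSteps-++ []      L′ y = refl
etaSteps-++ (i ∷ L) L′ y = etaSteps-++ L L′ (etaStep i y)

ascbotB-inner : ∀ x m → suc (suc (suc m)) ≤ length x →
                ascbotB x (suc (suc m)) ≡ (at x (suc (suc m)) <ᵇ at x (suc (suc (suc m))))
ascbotB-inner x m inside rewrite dec-true (suc (suc (suc m)) ≤? length x) inside = refl

ascbotB-beyond : ∀ x m → length x ≤ suc (suc m) → ascbotB x (suc (suc m)) ≡ false
ascbotB-beyond x m last
  rewrite dec-false (suc (suc (suc m)) ≤? length x) (λ inside → 1+n≰n (≤-trans inside last)) = refl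

ascbotB-∷ʳ : ∀ (y : List ℕ) a i → suc i ≤ length y → ascbotB (y ∷ʳ a) i ≡ ascbotB y i
ascbotB-∷ʳ y a zero          _         = refl
ascbotB-∷ʳ y a (suc zero)    _         = refl
ascbotB-∷ʳ y a (suc (suc m)) inside
  rewrite ascbotB-inner (y ∷ʳ a) m (≤-trans (m≤n⇒m≤1+n inside) (≤-reflexive (sym (length-∷ʳ y a))))
        | ascbotB-inner y m inside
        | at-++ˡ y [ a ] (<⇒≤ inside)
        | at-++ˡ y [ a ] inside = refl

filter-T?-[_] : ∀ (f : ℕ → Bool) j → filter (λ i → T? (f i)) [ j ] ≡ (if f j then [ j ] else [])
filter-T?-[ f ] j with f j
... | true  = refl
... | false = refl

ascbotUpTo : List ℕ → ℕ → List ℕ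
ascbotUpTo x k = filter (λ i → T? (ascbotB x i)) (applyUpTo suc k)

ascbotUpTo-suc : ∀ x k →
  ascbotUpTo x (suc k) ≡ ascbotUpTo x k ++ (if ascbotB x (suc k) then [ suc k ] else [])
ascbotUpTo-suc x k = begin
  filter P? (applyUpTo suc (suc k))            ≡⟨ cong (filter P?) (applyUpTo-∷ʳ suc k) ⟨
  filter P? (applyUpTo suc k ∷ʳ suc k)         ≡⟨ filter-++ P? (applyUpTo suc k) [ suc k ] ⟩
  ascbotUpTo x k ++ filter P? [ suc k ]        ≡⟨ cong (ascbotUpTo x k ++_) (filter-T?-[ ascbotB x ] (suc k)) ⟩
  ascbotUpTo x k ++ (if ascbotB x (suc k) then [ suc k ] else []) ∎
  where
  open ≡-Reasoning
  P? = λ i → T? (ascbotB x i)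

ascbotUpTo-bounded : ∀ x k → All (_≤ k) (ascbotUpTo x k)
ascbotUpTo-bounded x k =
  Allₚ.filter⁺ (λ i → T? (ascbotB x i)) (Allₚ.applyUpTo⁺₁ suc k (λ i<k → i<k))

ascbotUpTo-∷ʳ : ∀ (y : List ℕ) a k → k < length y → ascbotUpTo (y ∷ʳ a) k ≡ ascbotUpTo y k
ascbotUpTo-∷ʳ y a zero    _ = refl
ascbotUpTo-∷ʳ y a (suc k) k+1<∣y∣
  rewrite ascbotUpTo-suc (y ∷ʳ a) k | ascbotUpTo-suc y k
        | ascbotUpTo-∷ʳ y a k (<-trans (n<1+n k) k+1<∣y∣)
        | ascbotB-∷ʳ y a (suc k) k+1<∣y∣ = refl

ascbotUpTo-last : ∀ x m → length x ≤ suc (suc m) → ascbotUpTo x (suc (suc m)) ≡ ascbotUpTo x (suc m)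
ascbotUpTo-last x m ∣x∣≤ = begin
  ascbotUpTo x (suc (suc m))
    ≡⟨ ascbotUpTo-suc x (suc m) ⟩
  ascbotUpTo x (suc m) ++ (if ascbotB x (suc (suc m)) then [ suc (suc m) ] else [])
    ≡⟨ cong (λ β → ascbotUpTo x (suc m) ++ (if β then [ suc (suc m) ] else [])) (ascbotB-beyond x m ∣x∣≤) ⟩
  ascbotUpTo x (suc m) ++ []
    ≡⟨ ++-identityʳ _ ⟩
  ascbotUpTo x (suc m) ∎
  where open ≡-Reasoning

ascbotList-∷ʳ : ∀ c p b → ascbotList ((c ∷ p) ∷ʳ b) ≡ ascbotUpTo ((c ∷ p) ∷ʳ b) (length (c ∷ p))
ascbotList-∷ʳ c p b =
  trans (cong (ascbotUpTo x) ∣x∣≡) (ascbotUpTo-last x (length p) (≤-reflexive ∣x∣≡))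
  where
  x = (c ∷ p) ∷ʳ b
  ∣x∣≡ = length-∷ʳ (c ∷ p) b

ascbotB-∷ʳ-∷ʳ : ∀ c p b a → ascbotB ((c ∷ p) ∷ʳ b ∷ʳ a) (suc (length (c ∷ p))) ≡ (b <ᵇ a)
ascbotB-∷ʳ-∷ʳ c p b a =
  trans (ascbotB-inner x (length p) (≤-reflexive (sym (length-∷ʳ-∷ʳ (c ∷ p) b a))))
        (cong₂ _<ᵇ_ (trans (cong (λ w → at w (suc k)) x≡) (at-middle (c ∷ p) b [ a ]))
                    (trans (cong (λ w → at w (suc (suc k))) x≡) (at-next (c ∷ p) b a [])))
  where
  x = (c ∷ p) ∷ʳ b ∷ʳ a
  k = length (c ∷ p)
  x≡ : x ≡ (c ∷ p) ++ b ∷ a ∷ []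
  x≡ = cong (c ∷_) (++-assoc p [ b ] [ a ])

ascbotList-∷ʳ-∷ʳ : ∀ c p b a → ascbotList ((c ∷ p) ∷ʳ b ∷ʳ a) ≡
  ascbotUpTo ((c ∷ p) ∷ʳ b) (length (c ∷ p)) ++ (if b <ᵇ a then [ suc (length (c ∷ p)) ] else [])
ascbotList-∷ʳ-∷ʳ c p b a = begin
  ascbotUpTo x (length x)                         ≡⟨ cong (ascbotUpTo x) ∣x∣≡ ⟩
  ascbotUpTo x (suc (suc k))                      ≡⟨ ascbotUpTo-last x k (≤-reflexive ∣x∣≡) ⟩
  ascbotUpTo x (suc k)                            ≡⟨ ascbotUpTo-suc x k ⟩
  ascbotUpTo x k ++ (if ascbotB x (suc k) then [ suc k ] else [])
    ≡⟨ cong₂ (λ L β → L ++ (if β then [ suc k ] else []))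
             (ascbotUpTo-∷ʳ ((c ∷ p) ∷ʳ b) a k (≤-reflexive (sym (length-∷ʳ (c ∷ p) b))))
             (ascbotB-∷ʳ-∷ʳ c p b a) ⟩
  ascbotUpTo ((c ∷ p) ∷ʳ b) k ++ (if b <ᵇ a then [ suc k ] else []) ∎
  where
  open ≡-Reasoning
  x = (c ∷ p) ∷ʳ b ∷ʳ a
  k = length (c ∷ p)
  ∣x∣≡ = length-∷ʳ-∷ʳ (c ∷ p) b a

ηTail : List ℕ → List ℕ
ηTail x = etaSteps (ascbotList x) x

length-ηTail : ∀ x → length (ηTail x) ≡ length x
length-ηTail x = length-etaSteps (ascbotList x) x

bumpIfAscent : ℕ → ℕ → List ℕ → List ℕ
bumpIfAscent b a u = if b <ᵇ a then map (bump b) u else u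

bumpIfAscent-< : ∀ {b a} u → b < a → bumpIfAscent b a u ≡ map (bump b) u
bumpIfAscent-< {b} {a} u b<a rewrite dec-true (b <? a) b<a = refl

bumpIfAscent-≮ : ∀ {b a} u → ¬ b < a → bumpIfAscent b a u ≡ u
bumpIfAscent-≮ {b} {a} u b≮a rewrite dec-false (b <? a) b≮a = refl

etaSteps-lastPair : ∀ (u : List ℕ) b a →
  etaSteps (if b <ᵇ a then [ suc (length u) ] else []) (u ∷ʳ b ∷ʳ a) ≡ bumpIfAscent b a u ∷ʳ b ∷ʳ a
etaSteps-lastPair u b a with b <ᵇ a
... | false = refl
... | true  = trans (etaStep-∷ʳ (suc (length u)) (u ∷ʳ b) a (≤-reflexive (sym (length-∷ʳ u b))))
                    (cong (_∷ʳ a) (etaStep-last u b))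

-- The steps of η for the positions of p do not see the letters after p, and the
-- last position is never an ascent bottom of a word of length ≥ 2; appending a
-- only adds the step at the position of b, and only when b < a.
ηTail-∷ʳ : ∀ p b → ∃ λ u → ηTail (p ∷ʳ b) ≡ u ∷ʳ b
                         × (∀ a → ηTail (p ∷ʳ b ∷ʳ a) ≡ bumpIfAscent b a u ∷ʳ b ∷ʳ a)
ηTail-∷ʳ []      b = [] , refl , pair
  where
  pair : ∀ a → b ∷ a ∷ [] ≡ bumpIfAscent b a [] ∷ʳ b ∷ʳ a
  pair a with b <ᵇ a
  ... | true  = refl
  ... | false = refl
ηTail-∷ʳ (c ∷ p) b = u , single , pair
  where
  open ≡-Reasoning
  k = length (c ∷ p)
  L = ascbotUpTo ((c ∷ p) ∷ʳ b) k
  u = etaSteps L (c ∷ p)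
  L≤k : All (_≤ k) L
  L≤k = ascbotUpTo-bounded ((c ∷ p) ∷ʳ b) k
  single : ηTail ((c ∷ p) ∷ʳ b) ≡ u ∷ʳ b
  single = trans (cong (λ L′ → etaSteps L′ ((c ∷ p) ∷ʳ b)) (ascbotList-∷ʳ c p b))
                 (etaSteps-∷ʳ L (c ∷ p) b L≤k)
  pair : ∀ a → ηTail ((c ∷ p) ∷ʳ b ∷ʳ a) ≡ bumpIfAscent b a u ∷ʳ b ∷ʳ a
  pair a = begin
    etaSteps (ascbotList x) x
      ≡⟨ cong (λ L′ → etaSteps L′ x) (ascbotList-∷ʳ-∷ʳ c p b a) ⟩
    etaSteps (L ++ last) x
      ≡⟨ etaSteps-++ L last x ⟩
    etaSteps last (etaSteps L x)
      ≡⟨ cong (etaSteps last) (etaSteps-∷ʳ L ((c ∷ p) ∷ʳ b) a L≤∣cpb∣) ⟩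
    etaSteps last (etaSteps L ((c ∷ p) ∷ʳ b) ∷ʳ a)
      ≡⟨ cong (λ w → etaSteps last (w ∷ʳ a)) (etaSteps-∷ʳ L (c ∷ p) b L≤k) ⟩
    etaSteps last (u ∷ʳ b ∷ʳ a)
      ≡⟨ cong (λ n → etaSteps (if b <ᵇ a then [ suc n ] else []) (u ∷ʳ b ∷ʳ a)) (sym (length-etaSteps L (c ∷ p))) ⟩
    etaSteps (if b <ᵇ a then [ suc (length u) ] else []) (u ∷ʳ b ∷ʳ a)
      ≡⟨ etaSteps-lastPair u b a ⟩
    bumpIfAscent b a u ∷ʳ b ∷ʳ a ∎
    where
    x = (c ∷ p) ∷ʳ b ∷ʳ a
    last = if b <ᵇ a then [ suc k ] else []
    L≤∣cpb∣ : All (_≤ length ((c ∷ p) ∷ʳ b)) L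
    L≤∣cpb∣ = All.map (λ i≤k → ≤-trans (m≤n⇒m≤1+n i≤k) (≤-reflexive (sym (length-∷ʳ (c ∷ p) b))))
                      L≤k

ηTail-extend : ∀ y {q b} a → ηTail y ≡ q ∷ʳ b → ηTail (y ∷ʳ a) ≡ bumpIfAscent b a q ∷ʳ b ∷ʳ a
ηTail-extend y a ηy≡q∷ʳb with initLast y
... | []       = contradiction ηy≡q∷ʳb ([]≢∷ʳ _ _)
... | p ∷ʳ′ b′ with ηTail-∷ʳ p b′
...   | u , single , pair with ∷ʳ-injective u _ (trans (sym single) ηy≡q∷ʳb)
...     | refl , refl = pair a

ηTail-last : ∀ y {q b} → ηTail y ≡ q ∷ʳ b → ∃ λ p → y ≡ p ∷ʳ b
ηTail-last y ηy≡q∷ʳb with initLast y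
... | []       = contradiction ηy≡q∷ʳb ([]≢∷ʳ _ _)
... | p ∷ʳ′ b′ with ηTail-∷ʳ p b′
...   | u , single , _ with ∷ʳ-injective u _ (trans (sym single) ηy≡q∷ʳb)
...     | _ , refl = p , refl

-- Ascent sequences

ascentBit : ℕ → ℕ → ℕ
ascentBit b a = if b <ᵇ a then 1 else 0

ascCount-∷ʳ-∷ʳ : ∀ p b a → ascCount (p ∷ʳ b ∷ʳ a) ≡ ascentBit b a + ascCount (p ∷ʳ b)
ascCount-∷ʳ-∷ʳ []          b a = refl
ascCount-∷ʳ-∷ʳ (c ∷ [])    b a = x∙yz≈y∙xz (ascentBit c b) (ascentBit b a) 0
ascCount-∷ʳ-∷ʳ (c ∷ d ∷ p) b a =
  trans (cong (ascentBit c d +_) (ascCount-∷ʳ-∷ʳ (d ∷ p) b a))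
        (x∙yz≈y∙xz (ascentBit c d) (ascentBit b a) (ascCount ((d ∷ p) ∷ʳ b)))

asctop-< : ∀ p {b a} → b < a → asctop (p ∷ʳ b ∷ʳ a) ≡ suc (asctop (p ∷ʳ b))
asctop-< p {b} {a} b<a rewrite ascCount-∷ʳ-∷ʳ p b a | dec-true (b <? a) b<a = refl

asctop-≮ : ∀ p {b a} → ¬ b < a → asctop (p ∷ʳ b ∷ʳ a) ≡ asctop (p ∷ʳ b)
asctop-≮ p {b} {a} b≮a rewrite ascCount-∷ʳ-∷ʳ p b a | dec-false (b <? a) b≮a = refl

asctop≤length : ∀ c y → asctop (c ∷ y) ≤ length (c ∷ y)
asctop≤length c y = s≤s (ascCount≤ c y)
  where
  ascCount≤ : ∀ c y → ascCount (c ∷ y) ≤ length y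
  ascCount≤ c []      = z≤n
  ascCount≤ c (d ∷ y) with c <ᵇ d
  ... | true  = s≤s (ascCount≤ d y)
  ... | false = m≤n⇒m≤1+n (ascCount≤ d y)

AscentAt : List ℕ → ℕ → Set
AscentAt x i = (1 ≤ at x i) × (at x i ≤ asctop (take (i ∸ 1) x) + 1)

AscentCondition : List ℕ → Set
AscentCondition x = ∀ i → 2 ≤ i → i ≤ length x → AscentAt x i

AscentAt-∷ʳ : ∀ x a {i} → i ≤ length x → AscentAt (x ∷ʳ a) i ≡ AscentAt x i
AscentAt-∷ʳ x a {i} i≤∣x∣
  rewrite at-++ˡ x [ a ] i≤∣x∣ | take-++ˡ (i ∸ 1) x [ a ] (≤-trans (m∸n≤m i 1) i≤∣x∣) = refl

AscentAt-last : ∀ x a → AscentAt (x ∷ʳ a) (suc (length x)) ≡ (1 ≤ a × a ≤ asctop x + 1)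
AscentAt-last x a
  rewrite at-middle x a [] | take-++ˡ (length x) x [ a ] ≤-refl | take-all (length x) x ≤-refl = refl

AscentCondition-∷ʳ : ∀ x a → 1 ≤ length x →
  AscentCondition (x ∷ʳ a) ⇔ (AscentCondition x × 1 ≤ a × a ≤ asctop x + 1)
AscentCondition-∷ʳ x a 1≤∣x∣ = mk⇔
  (λ ac → (λ i 2≤i i≤∣x∣ → subst id (AscentAt-∷ʳ x a i≤∣x∣) (ac i 2≤i (≤-trans i≤∣x∣ ∣x∣≤∣x∷ʳa∣)))
        , subst id (AscentAt-last x a) (ac (suc (length x)) (s≤s 1≤∣x∣) (≤-reflexive (sym (length-∷ʳ x a)))))
  (λ (acx , last) i 2≤i i≤∣x∷ʳa∣ → case m≤n⇒m<n∨m≡n (subst (i ≤_) (length-∷ʳ x a) i≤∣x∷ʳa∣) of λ where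
     (inj₁ (s≤s i≤∣x∣)) → subst id (sym (AscentAt-∷ʳ x a i≤∣x∣)) (acx i 2≤i i≤∣x∣)
     (inj₂ refl)        → subst id (sym (AscentAt-last x a)) last)
  where
  ∣x∣≤∣x∷ʳa∣ : length x ≤ length (x ∷ʳ a)
  ∣x∣≤∣x∷ʳa∣ = ≤-trans (n≤1+n _) (≤-reflexive (sym (length-∷ʳ x a)))

AscentCondition⇒IsEndo : ∀ x → at x 1 ≡ 1 → AscentCondition x → IsEndo x
AscentCondition⇒IsEndo x       x₁≡1 ac (suc zero)    _  1≤∣x∣ =
  ≤-reflexive (sym x₁≡1) , ≤-trans (≤-reflexive x₁≡1) 1≤∣x∣
AscentCondition⇒IsEndo []      _    ac (suc (suc m)) _  ()
AscentCondition⇒IsEndo (c ∷ x) _    ac (suc (suc m)) _  i≤∣x∣ with ac (suc (suc m)) (s≤s (s≤s z≤n)) i≤∣x∣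
... | 1≤xᵢ , xᵢ≤ = 1≤xᵢ , (begin
    at (c ∷ x) (suc (suc m))       ≤⟨ xᵢ≤ ⟩
    asctop (c ∷ take m x) + 1      ≤⟨ +-monoˡ-≤ 1 (asctop≤length c (take m x)) ⟩
    suc (length (take m x)) + 1    ≡⟨ +-comm _ 1 ⟩
    suc (suc (length (take m x)))  ≤⟨ s≤s (s≤s (length-take≤ m x)) ⟩
    suc (suc m)                    ≤⟨ i≤∣x∣ ⟩
    length (c ∷ x)                 ∎)
  where open ≤-Reasoning

IsAscentSeq-∷ʳ : ∀ x a → 1 ≤ length x →
  IsAscentSeq (x ∷ʳ a) ⇔ (IsAscentSeq x × 1 ≤ a × a ≤ asctop x + 1)
IsAscentSeq-∷ʳ x a 1≤∣x∣ = mk⇔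
  (λ (_ , first , ac) → let (acx , last) = to (AscentCondition-∷ʳ x a 1≤∣x∣) ac
                            first′ = trans (sym x₁-∷ʳ) first
                        in (AscentCondition⇒IsEndo x first′ acx , first′ , acx) , last)
  (λ ((_ , first , acx) , last) → let first′ = trans x₁-∷ʳ first
                                      ac = from (AscentCondition-∷ʳ x a 1≤∣x∣) (acx , last)
                                  in AscentCondition⇒IsEndo (x ∷ʳ a) first′ ac , first′ , ac)
  where
  x₁-∷ʳ : at (x ∷ʳ a) 1 ≡ at x 1
  x₁-∷ʳ = at-++ˡ x [ a ] 1≤∣x∣

IsAscentSeq-[1] : IsAscentSeq [ 1 ]
IsAscentSeq-[1] = AscentCondition⇒IsEndo [ 1 ] refl none , refl , none
  where
  none : AscentCondition [ 1 ]
  none (suc zero)    (s≤s ()) _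
  none (suc (suc _)) _        (s≤s ())

-- Ascbot = Nub as a local condition

⇔-cong : ∀ {A A′ B B′ : Set} → A ⇔ A′ → B ⇔ B′ → (A ⇔ B) ⇔ (A′ ⇔ B′)
⇔-cong A⇔A′ B⇔B′ = mk⇔ (λ A⇔B → ⇔-trans (⇔-trans (⇔-sym A⇔A′) A⇔B) B⇔B′)
                       (λ A′⇔B′ → ⇔-trans (⇔-trans A⇔A′ A′⇔B′) (⇔-sym B⇔B′))

-- The letter c, read after the prefix s and followed by e (nothing at the end of
-- the word, where there is no ascent), is an ascent bottom iff it is new.
AscentIffNew : List ℕ → ℕ → Maybe ℕ → Set
AscentIffNew s c nothing  = c ∈ s
AscentIffNew s c (just d) = c < d ⇔ c ∉ s

next : List ℕ → Maybe ℕ → Maybe ℕ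
next []      e = e
next (d ∷ _) e = just d

LocallyRevised : List ℕ → List ℕ → Maybe ℕ → Set
LocallyRevised s []      e = ⊤
LocallyRevised s (c ∷ r) e = AscentIffNew s c (next r e) × LocallyRevised (s ∷ʳ c) r e

LocallyRevised-∷ʳ : ∀ s r c e →
  LocallyRevised s (r ∷ʳ c) e ⇔ (LocallyRevised s r (just c) × AscentIffNew (s ++ r) c e)
LocallyRevised-∷ʳ s []      c e =
  mk⇔ (λ (new , _) → tt , subst (λ t → AscentIffNew t c e) (sym (++-identityʳ s)) new)
      (λ (_ , new) → subst (λ t → AscentIffNew t c e) (++-identityʳ s) new , tt)
LocallyRevised-∷ʳ s (d ∷ r) c e =
  mk⇔ (λ (new , rest) → let (rest′ , newc) = to IH rest
                        in (subst (AscentIffNew s d) (next-∷ʳ r) new , rest′)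
                         , subst (λ t → AscentIffNew t c e) (∷ʳ-++ s d r) newc)
      (λ ((new , rest′) , newc) → subst (AscentIffNew s d) (sym (next-∷ʳ r)) new
                                , from IH (rest′ , subst (λ t → AscentIffNew t c e) (sym (∷ʳ-++ s d r)) newc))
  where
  IH = LocallyRevised-∷ʳ (s ∷ʳ d) r c e
  next-∷ʳ : ∀ r → next (r ∷ʳ c) e ≡ next r (just c)
  next-∷ʳ []      = refl
  next-∷ʳ (_ ∷ _) = refl

-- A new letter is followed by a larger one, and the last letter is old.
LocallyRevised-max : ∀ s r {m} → LocallyRevised s r nothing → m ∈ r → All (_≤ m) r → m ∈ s
LocallyRevised-max s (c ∷ r) (new , _) (here refl) (_ ∷ r≤c) = old r new r≤c
  where
  old : ∀ r → AscentIffNew s c (next r nothing) → All (_≤ c) r → c ∈ s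
  old []      c∈s            _          = c∈s
  old (d ∷ _) c<d⇔c∉s        (d≤c ∷ _) = decidable-stable (c ∈? s) (λ c∉s → <⇒≱ (from c<d⇔c∉s c∉s) d≤c)
LocallyRevised-max s (c ∷ r) rev@(_ , rest) (there m∈r) r≤m@(_ ∷ r′≤m)
  with ∈-++⁻ s (LocallyRevised-max (s ∷ʳ c) r rest m∈r r′≤m)
... | inj₁ m∈s         = m∈s
... | inj₂ (here refl) = LocallyRevised-max s (c ∷ r) rev (here refl) r≤m

module OrderEmbedding (f : ℕ → ℕ) (f-mono : ∀ {u v} → u < v → f u < f v) where

  f-reflects : ∀ {u v} → f u < f v → u < v
  f-reflects {u} {v} fu<fv with <-cmp u v
  ... | tri< u<v _ _ = u<v
  ... | tri≈ _ refl _ = contradiction fu<fv (<-irrefl refl)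
  ... | tri> _ _ v<u = contradiction fu<fv (<-asym (f-mono v<u))

  f-injective : ∀ {u v} → f u ≡ f v → u ≡ v
  f-injective {u} {v} fu≡fv with <-cmp u v
  ... | tri< u<v _ _ = contradiction fu≡fv (<⇒≢ (f-mono u<v))
  ... | tri≈ _ u≡v _ = u≡v
  ... | tri> _ _ v<u = contradiction (sym fu≡fv) (<⇒≢ (f-mono v<u))

  ∈-map-f : ∀ {c} s → c ∈ s ⇔ f c ∈ map f s
  ∈-map-f s = mk⇔ (∈-map⁺ f) λ fc∈ →
    let (_ , c′∈s , fc≡fc′) = ∈-map⁻ f fc∈ in subst (_∈ s) (sym (f-injective fc≡fc′)) c′∈s

  CutsMatch : Maybe ℕ → Maybe ℕ → Set
  CutsMatch nothing  nothing   = ⊤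
  CutsMatch (just d) (just d′) = ∀ c → c < d ⇔ f c < d′
  CutsMatch _        _         = ⊥

  AscentIffNew-map : ∀ s c {e e′} → CutsMatch e e′ → AscentIffNew s c e ⇔ AscentIffNew (map f s) (f c) e′
  AscentIffNew-map s c {nothing} {nothing} _    = ∈-map-f s
  AscentIffNew-map s c {just d}  {just d′} cuts = ⇔-cong (cuts c) (¬-cong-⇔ (∈-map-f s))

  next-map : ∀ r {e e′} → CutsMatch e e′ → CutsMatch (next r e) (next (map f r) e′)
  next-map []      cuts = cuts
  next-map (d ∷ r) _    = λ c → mk⇔ f-mono f-reflects

  LocallyRevised-map : ∀ s r {e e′} → CutsMatch e e′ →
                       LocallyRevised s r e ⇔ LocallyRevised (map f s) (map f r) e′
  LocallyRevised-map s []      _    = mk⇔ (λ _ → tt) (λ _ → tt)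
  LocallyRevised-map s (c ∷ r) {e} {e′} cuts =
    AscentIffNew-map s c (next-map r cuts) ×-⇔
    subst (λ t → LocallyRevised (s ∷ʳ c) r e ⇔ LocallyRevised t (map f r) e′) (map-++ f s [ c ])
          (LocallyRevised-map (s ∷ʳ c) r cuts)

module BumpEmbedding (b : ℕ) = OrderEmbedding (bump b) (bump-strictMono b)

InNub-middle : ∀ s c r → InNub (s ++ c ∷ r) (suc (length s)) ⇔ c ∉ s
InNub-middle s c r = mk⇔
  (λ (_ , _ , leftmost) c∈s → let (j , 1≤j , j≤∣s∣ , sⱼ≡c) = ∈⇒at s c∈s in
     leftmost j 1≤j (s≤s j≤∣s∣) (trans (at-++ˡ s (c ∷ r) j≤∣s∣) (trans sⱼ≡c (sym (at-middle s c r)))))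
  (λ c∉s → s≤s z≤n
         , ≤-trans (s≤s (m≤m+n (length s) (length r))) (≤-reflexive (sym (length-middle s c r)))
         , λ j 1≤j j≤∣s∣ zⱼ≡c →
             c∉s (subst (_∈ s) (trans (sym (at-++ˡ s (c ∷ r) (≤-pred j≤∣s∣))) (trans zⱼ≡c (at-middle s c r)))
                       (at-∈ s 1≤j (≤-pred j≤∣s∣))))

InAscbot-middle : ∀ x s c d r → InAscbot (x ∷ s ++ c ∷ d ∷ r) (suc (suc (length s))) ⇔ c < d
InAscbot-middle x s c d r =
  subst (λ β → T β ⇔ c < d)
        (sym (trans (ascbotB-inner (x ∷ s ++ c ∷ d ∷ r) (length s) inside)
                    (cong₂ _<ᵇ_ (at-middle s c (d ∷ r)) (at-next s c d r))))
        (mk⇔ (<ᵇ⇒< c d) <⇒<ᵇ)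
  where
  inside : suc (suc (suc (length s))) ≤ length (x ∷ s ++ c ∷ d ∷ r)
  inside = s≤s (≤-trans (s≤s (subst (suc (length s) ≤_) (sym (+-suc (length s) (length r))) (s≤s (m≤m+n _ _))))
                        (≤-reflexive (sym (length-middle s c (d ∷ r)))))

¬InAscbot-last : ∀ x s c → ¬ InAscbot (x ∷ s ++ [ c ]) (suc (suc (length s)))
¬InAscbot-last x s c =
  subst T (ascbotB-beyond (x ∷ s ++ [ c ]) (length s) (≤-reflexive (cong suc (length-∷ʳ s c))))

AscbotIffNub : List ℕ → ℕ → Set
AscbotIffNub z i = InAscbot z i ⇔ InNub z i

AscentIffNew⇔AscbotIffNub : ∀ x s c r →
  AscentIffNew (x ∷ s) c (next r nothing) ⇔ AscbotIffNub (x ∷ s ++ c ∷ r) (suc (length (x ∷ s)))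
AscentIffNew⇔AscbotIffNub x s c [] = mk⇔
  (λ c∈ → mk⇔ (λ asc → contradiction asc (¬InAscbot-last x s c))
              (λ nub → contradiction c∈ (to (InNub-middle (x ∷ s) c []) nub)))
  (λ asc⇔nub → decidable-stable (c ∈? x ∷ s)
                 (λ c∉ → ¬InAscbot-last x s c (from asc⇔nub (from (InNub-middle (x ∷ s) c []) c∉))))
AscentIffNew⇔AscbotIffNub x s c (d ∷ r) =
  ⇔-cong (⇔-sym (InAscbot-middle x s c d r)) (⇔-sym (InNub-middle (x ∷ s) c (d ∷ r)))

LocallyRevised⇔AscbotIffNub : ∀ x s r → LocallyRevised (x ∷ s) r nothing ⇔
  (∀ i → length (x ∷ s) < i → i ≤ length (x ∷ s ++ r) → AscbotIffNub (x ∷ s ++ r) i)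
LocallyRevised⇔AscbotIffNub x s [] = mk⇔
  (λ _ i ∣s∣<i i≤∣s∣ →
     contradiction (≤-trans i≤∣s∣ (≤-reflexive (cong (length ∘ (x ∷_)) (++-identityʳ s)))) (<⇒≱ ∣s∣<i))
  (λ _ → tt)
LocallyRevised⇔AscbotIffNub x s (c ∷ r) = mk⇔
  (λ (new , rest) i ∣s∣<i i≤∣z∣ → case m≤n⇒m<n∨m≡n ∣s∣<i of λ where
     (inj₂ refl)   → to (AscentIffNew⇔AscbotIffNub x s c r) new
     (inj₁ ∣s∣+1<i) → later (to IH rest) i (subst (_< i) (sym ∣s∷ʳc∣) ∣s∣+1<i) i≤∣z∣)
  (λ positions → from (AscentIffNew⇔AscbotIffNub x s c r) (positions _ ≤-refl here≤∣z∣)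
               , from IH (subst Later (sym same)
                                (λ i ∣s∷ʳc∣<i → positions i (<-trans (n<1+n _) (subst (_< i) ∣s∷ʳc∣ ∣s∷ʳc∣<i)))))
  where
  IH = LocallyRevised⇔AscbotIffNub x (s ∷ʳ c) r
  same : x ∷ s ∷ʳ c ++ r ≡ x ∷ s ++ c ∷ r
  same = cong (x ∷_) (∷ʳ-++ s c r)
  ∣s∷ʳc∣ : length (x ∷ s ∷ʳ c) ≡ suc (length (x ∷ s))
  ∣s∷ʳc∣ = cong suc (length-∷ʳ s c)
  Later : List ℕ → Set
  Later w = ∀ i → length (x ∷ s ∷ʳ c) < i → i ≤ length w → AscbotIffNub w i
  later = subst Later same
  here≤∣z∣ : suc (length (x ∷ s)) ≤ length (x ∷ s ++ c ∷ r)
  here≤∣z∣ = s≤s (≤-trans (s≤s (m≤m+n (length s) (length r))) (≤-reflexive (sym (length-middle s c r))))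

AscbotIffNub⇔LocallyRevised : ∀ c r → (∀ i → AscbotIffNub (c ∷ r) i) ⇔ LocallyRevised [ c ] r nothing
AscbotIffNub⇔LocallyRevised c r = mk⇔
  (λ positions → from (LocallyRevised⇔AscbotIffNub c [] r) (λ i _ _ → positions i))
  (λ rev → position (to (LocallyRevised⇔AscbotIffNub c [] r) rev))
  where
  position : (∀ i → 1 < i → i ≤ length (c ∷ r) → AscbotIffNub (c ∷ r) i) → ∀ i → AscbotIffNub (c ∷ r) i
  position _     zero          = mk⇔ (λ ()) (λ ())
  position _     (suc zero)    = mk⇔ (λ _ → s≤s z≤n , s≤s z≤n , λ { (suc _) (s≤s 1≤j) (s≤s ()) _ }) (λ _ → tt)
  position inner (suc (suc m)) with suc (suc m) ≤? length (c ∷ r)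
  ... | yes i≤∣z∣ = inner (suc (suc m)) (s≤s (s≤s z≤n)) i≤∣z∣
  ... | no  i≰∣z∣ =
    mk⇔ (λ asc → contradiction asc (subst T (ascbotB-beyond (c ∷ r) m (<⇒≤ (≰⇒> i≰∣z∣)))))
        (λ (_ , i≤∣z∣ , _) → contradiction i≤∣z∣ i≰∣z∣)

-- The image of η

ImageUpTo : ℕ → List ℕ → Set
ImageUpTo M w = ∀ v → v ∈ w ⇔ (1 ≤ v × v ≤ M)

ImageUpTo-resp : ∀ {M w w′} → (∀ {v} → v ∈ w ⇔ v ∈ w′) → ImageUpTo M w → ImageUpTo M w′
ImageUpTo-resp same img v = ⇔-trans (⇔-sym same) (img v)

∈-∷ʳ⇔∈-∷ : ∀ {v : ℕ} w b → v ∈ w ∷ʳ b ⇔ v ∈ b ∷ w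
∈-∷ʳ⇔∈-∷ w b = mk⇔ (∈-resp-↭ (↭-sym (∷↭∷ʳ b w))) (∈-resp-↭ (∷↭∷ʳ b w))

ImageUpTo-∷ʳ⇔∷ : ∀ {M} w b → ImageUpTo M (w ∷ʳ b) ⇔ ImageUpTo M (b ∷ w)
ImageUpTo-∷ʳ⇔∷ w b = mk⇔ (ImageUpTo-resp (∈-∷ʳ⇔∈-∷ w b)) (ImageUpTo-resp (⇔-sym (∈-∷ʳ⇔∈-∷ w b)))

ImageUpTo-∷ʳ-redundant : ∀ {M w b} → b ∈ w → ImageUpTo M (w ∷ʳ b) ⇔ ImageUpTo M w
ImageUpTo-∷ʳ-redundant {w = w} {b} b∈w =
  mk⇔ (ImageUpTo-resp same) (ImageUpTo-resp (⇔-sym same))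
  where
  same : ∀ {v} → v ∈ w ∷ʳ b ⇔ v ∈ w
  same = ⇔-trans (∈-∷ʳ⇔∈-∷ w b) (mk⇔ (λ { (here refl) → b∈w ; (there v∈w) → v∈w }) there)

ImageUpTo-bump : ∀ {M b w} → 1 ≤ b → b ≤ suc M → ImageUpTo M w → ImageUpTo (suc M) (b ∷ map (bump b) w)
ImageUpTo-bump {M} {b} {w} 1≤b b≤M+1 img v = mk⇔ into onto
  where
  open BumpEmbedding b
  into : ∀ {v} → v ∈ b ∷ map (bump b) w → 1 ≤ v × v ≤ suc M
  into (here refl) = 1≤b , b≤M+1
  into (there v∈) = let (u , u∈w , v≡bu) = ∈-map⁻ (bump b) v∈ in
    subst (λ t → 1 ≤ t × t ≤ suc M) (sym v≡bu) (to (bump-bounds 1≤b b≤M+1) (to (img u) u∈w))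
  onto : ∀ {v} → 1 ≤ v × v ≤ suc M → v ∈ b ∷ map (bump b) w
  onto {v} v-bounds with v ≟ b
  ... | yes refl = here refl
  ... | no  v≢b  =
    let bump-v′ = bump-unbump v≢b
        v′-bounds = from (bump-bounds 1≤b b≤M+1) (subst (λ t → 1 ≤ t × t ≤ suc M) (sym bump-v′) v-bounds)
    in there (subst (_∈ map (bump b) w) bump-v′ (to (∈-map-f w) (from (img _) v′-bounds)))

ImageUpTo-unbump : ∀ {M b w} → ImageUpTo (suc M) (b ∷ map (bump b) w) → ImageUpTo M w
ImageUpTo-unbump {M} {b} {w} img v = mk⇔ into onto
  where
  open BumpEmbedding b
  bounds⇔ : (1 ≤ v × v ≤ M) ⇔ (1 ≤ bump b v × bump b v ≤ suc M)
  bounds⇔ = let (1≤b , b≤M+1) = to (img b) (here refl) in bump-bounds 1≤b b≤M+1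
  into : v ∈ w → 1 ≤ v × v ≤ M
  into v∈w = from bounds⇔ (to (img (bump b v)) (there (to (∈-map-f w) v∈w)))
  onto : 1 ≤ v × v ≤ M → v ∈ w
  onto v-bounds with from (img (bump b v)) (to bounds⇔ v-bounds)
  ... | here bv≡b = contradiction bv≡b (bump-≢ b v)
  ... | there bv∈ = from (∈-map-f w) bv∈

IsCayley⇒ImageUpTo : ∀ z → IsCayley z → ImageUpTo (maxW z) z
IsCayley⇒ImageUpTo z (endo , onto) v = mk⇔
  (λ v∈z → let (i , 1≤i , i≤∣z∣ , zᵢ≡v) = ∈⇒at z v∈z in
           subst (1 ≤_) zᵢ≡v (proj₁ (endo i 1≤i i≤∣z∣)) , maxW-ub z v∈z)
  (λ (1≤v , v≤max) → onto v 1≤v v≤max)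

ImageUpTo⇒IsCayley : ∀ {M} z → ImageUpTo M z → M ≤ length z → IsCayley z
ImageUpTo⇒IsCayley {M} z img M≤∣z∣ =
  (λ i 1≤i i≤∣z∣ → let (1≤zᵢ , zᵢ≤M) = to (img (at z i)) (at-∈ z 1≤i i≤∣z∣)
                   in 1≤zᵢ , ≤-trans zᵢ≤M M≤∣z∣) ,
  (λ v 1≤v v≤max → from (img v) (1≤v , ≤-trans v≤max (maxW-lub z (proj₂ ∘ to (img _)))))

-- The words asctop x ∷ ηTail x: revised, with largest letter the first one.
RevisedTail : ℕ → List ℕ → Set
RevisedTail M y = LocallyRevised [ M ] y nothing × ImageUpTo M (M ∷ y)

revisedTail-[1] : RevisedTail 1 [ 1 ]
revisedTail-[1] =
  (here refl , tt) ,
  λ v → mk⇔ (λ { (here refl) → ≤-refl , ≤-refl ; (there (here refl)) → ≤-refl , ≤-refl })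
            (λ (1≤v , v≤1) → here (≤-antisym v≤1 1≤v))

revisedTail-singleton : ∀ {M c} → RevisedTail M [ c ] → M ≡ 1 × c ≡ 1
revisedTail-singleton {c = c} ((here refl , _) , img) with from (img 1) (≤-refl , proj₁ (to (img c) (here refl)))
... | here 1≡M         = sym 1≡M , sym 1≡M
... | there (here 1≡M) = sym 1≡M , sym 1≡M

revisedTail-≮ : ∀ {M q b a} → RevisedTail M (q ∷ʳ b) → 1 ≤ a → a ≤ b → RevisedTail M (q ∷ʳ b ∷ʳ a)
revisedTail-≮ {M} {q} {b} {a} (rev , img) 1≤a a≤b =
  from (LocallyRevised-∷ʳ [ M ] (q ∷ʳ b) a nothing)
       (from (LocallyRevised-∷ʳ [ M ] q b (just a)) (revq , b-old) , a∈) ,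
  from (ImageUpTo-∷ʳ-redundant a∈) img
  where
  revq = proj₁ (to (LocallyRevised-∷ʳ [ M ] q b nothing) rev)
  b∈ = proj₂ (to (LocallyRevised-∷ʳ [ M ] q b nothing) rev)
  b-old : b < a ⇔ b ∉ M ∷ q
  b-old = mk⇔ (λ b<a → contradiction a≤b (<⇒≱ b<a)) (λ b∉ → contradiction b∈ b∉)
  a∈ : a ∈ (M ∷ q) ∷ʳ b
  a∈ = from (img a) (1≤a , ≤-trans a≤b (proj₂ (to (img b) (∈-++⁺ʳ (M ∷ q) (here refl)))))

revisedTail-< : ∀ {M q b a} → RevisedTail M (q ∷ʳ b) → b < a → a ≤ suc M →
                RevisedTail (suc M) (map (bump b) q ∷ʳ b ∷ʳ a)
revisedTail-< {M} {q} {b} {a} (rev , img) b<a a≤M+1 =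
  from (LocallyRevised-∷ʳ [ suc M ] (q⁺ ∷ʳ b) a nothing)
       (from (LocallyRevised-∷ʳ [ suc M ] q⁺ b (just a)) (revq⁺ , b-new) , a∈) ,
  from (ImageUpTo-∷ʳ-redundant a∈) (from (ImageUpTo-∷ʳ⇔∷ (suc M ∷ q⁺) b) img⁺)
  where
  q⁺ = map (bump b) q
  revq = proj₁ (to (LocallyRevised-∷ʳ [ M ] q b nothing) rev)
  b∈ = proj₂ (to (LocallyRevised-∷ʳ [ M ] q b nothing) rev)
  1≤b = proj₁ (to (img b) (∈-++⁺ʳ (M ∷ q) (here refl)))
  b≤M = proj₂ (to (img b) (∈-++⁺ʳ (M ∷ q) (here refl)))
  bump-M : bump b M ≡ suc M
  bump-M = bump-≥ b≤M
  img⁺ : ImageUpTo (suc M) (b ∷ suc M ∷ q⁺)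
  img⁺ = subst (λ t → ImageUpTo (suc M) (b ∷ t ∷ q⁺)) bump-M
           (ImageUpTo-bump 1≤b (m≤n⇒m≤1+n b≤M) (to (ImageUpTo-∷ʳ-redundant b∈) img))
  revq⁺ : LocallyRevised [ suc M ] q⁺ (just b)
  revq⁺ = subst (λ t → LocallyRevised [ t ] q⁺ (just b)) bump-M
            (to (BumpEmbedding.LocallyRevised-map b [ M ] q (bump-cut b)) revq)
  b-new : b < a ⇔ b ∉ suc M ∷ q⁺
  b-new = mk⇔ (λ _ → subst (λ t → b ∉ t ∷ q⁺) bump-M (b∉map-bump b (M ∷ q))) (λ _ → b<a)
  a∈ : a ∈ (suc M ∷ q⁺) ∷ʳ b
  a∈ = from (∈-∷ʳ⇔∈-∷ (suc M ∷ q⁺) b) (from (img⁺ a) (≤-trans (s≤s z≤n) b<a , a≤M+1))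

revisedTail-≮⁻¹ : ∀ {M q b a} → RevisedTail M (q ∷ʳ b ∷ʳ a) → ¬ b < a → RevisedTail M (q ∷ʳ b)
revisedTail-≮⁻¹ {M} {q} {b} {a} (rev , img) b≮a =
  from (LocallyRevised-∷ʳ [ M ] q b nothing) (revq , b∈) , to (ImageUpTo-∷ʳ-redundant a∈) img
  where
  rev₁ = proj₁ (to (LocallyRevised-∷ʳ [ M ] (q ∷ʳ b) a nothing) rev)
  a∈ = proj₂ (to (LocallyRevised-∷ʳ [ M ] (q ∷ʳ b) a nothing) rev)
  revq = proj₁ (to (LocallyRevised-∷ʳ [ M ] q b (just a)) rev₁)
  b<a⇔b∉ = proj₂ (to (LocallyRevised-∷ʳ [ M ] q b (just a)) rev₁)
  b∈ : b ∈ M ∷ q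
  b∈ = decidable-stable (b ∈? M ∷ q) (λ b∉ → b≮a (from b<a⇔b∉ b∉))

revisedTail-<⁻¹ : ∀ {M q b a} → RevisedTail (suc M) (q ∷ʳ b ∷ʳ a) → b < a →
                  RevisedTail M (map (unbump b) q ∷ʳ b) × map (bump b) (map (unbump b) q) ≡ q
revisedTail-<⁻¹ {M} {q} {b} {a} (rev , img) b<a =
  (from (LocallyRevised-∷ʳ [ M ] q⁻ b nothing) (revq⁻ , b∈) , from (ImageUpTo-∷ʳ-redundant b∈) img⁻) , bump-q⁻
  where
  q⁻ = map (unbump b) q
  rev₁ = proj₁ (to (LocallyRevised-∷ʳ [ suc M ] (q ∷ʳ b) a nothing) rev)
  a∈ = proj₂ (to (LocallyRevised-∷ʳ [ suc M ] (q ∷ʳ b) a nothing) rev)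
  revq = proj₁ (to (LocallyRevised-∷ʳ [ suc M ] q b (just a)) rev₁)
  b∉ = to (proj₂ (to (LocallyRevised-∷ʳ [ suc M ] q b (just a)) rev₁)) b<a
  1≤b = proj₁ (to (img b) (∈-++⁺ˡ (∈-++⁺ʳ (suc M ∷ q) (here refl))))
  b≤M : b ≤ M
  b≤M = ≤-pred (≤-trans b<a (proj₂ (to (img a) (∈-++⁺ʳ (suc M ∷ q ∷ʳ b) (here refl)))))
  bump-q⁻ : map (bump b) q⁻ ≡ q
  bump-q⁻ = map-bump-unbump b q (b∉ ∘ there)
  img⁻ : ImageUpTo M (M ∷ q⁻)
  img⁻ = ImageUpTo-unbump (subst₂ (λ h t → ImageUpTo (suc M) (b ∷ h ∷ t)) (sym (bump-≥ b≤M)) (sym bump-q⁻)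
                             (to (ImageUpTo-∷ʳ⇔∷ (suc M ∷ q) b) (to (ImageUpTo-∷ʳ-redundant a∈) img)))
  b∈ : b ∈ M ∷ q⁻
  b∈ = from (img⁻ b) (1≤b , b≤M)
  revq⁻ : LocallyRevised [ M ] q⁻ (just b)
  revq⁻ = from (BumpEmbedding.LocallyRevised-map b [ M ] q⁻ (bump-cut b))
               (subst₂ (λ h t → LocallyRevised [ h ] t (just b)) (sym (bump-≥ b≤M)) (sym bump-q⁻) revq)

revisedTail-max : ∀ {M b y} → RevisedTail M (b ∷ y) → maxW (b ∷ y) ≡ M
revisedTail-max {M} {b} {y} (rev , _)
  with LocallyRevised-max [ M ] (b ∷ y) rev (maxW-∈ b y) (All.tabulate (maxW-ub (b ∷ y)))
... | here max≡M = max≡M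

revisedTail⇒IsRevised : ∀ {M y} → RevisedTail M y → M ≤ length (M ∷ y) → IsRevised (M ∷ y)
revisedTail⇒IsRevised {M} {y} (rev , img) M≤∣z∣ =
  ImageUpTo⇒IsCayley (M ∷ y) img M≤∣z∣ , from (AscbotIffNub⇔LocallyRevised M y) rev

IsRevised⇒revisedTail : ∀ {c r} → IsRevised (c ∷ r) → RevisedTail c r
IsRevised⇒revisedTail {c} {r} (cayley , positions) = rev , subst (λ M → ImageUpTo M (c ∷ r)) max≡c img
  where
  rev = to (AscbotIffNub⇔LocallyRevised c r) positions
  img = IsCayley⇒ImageUpTo (c ∷ r) cayley
  max∈ : maxW (c ∷ r) ∈ c ∷ r
  max∈ = from (img _) (≤-trans (proj₁ (to (img c) (here refl))) (maxW-ub (c ∷ r) (here refl)) , ≤-refl)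
  max≡c : maxW (c ∷ r) ≡ c
  max≡c with max∈
  ... | here max≡c  = max≡c
  ... | there max∈r with LocallyRevised-max [ c ] r rev max∈r (All.tabulate (λ v∈r → maxW-ub (c ∷ r) (there v∈r)))
  ...   | here max≡c = max≡c

revisedTail-step : ∀ p b a → RevisedTail (asctop (p ∷ʳ b)) (ηTail (p ∷ʳ b)) → 1 ≤ a → a ≤ asctop (p ∷ʳ b) + 1 →
                   RevisedTail (asctop (p ∷ʳ b ∷ʳ a)) (ηTail (p ∷ʳ b ∷ʳ a))
revisedTail-step p b a tail 1≤a a≤M+1 with ηTail-∷ʳ p b | b <? a
... | u , single , pair | yes b<a =
  subst₂ RevisedTail (sym (asctop-< p b<a)) (sym (trans (pair a) (cong (λ w → w ∷ʳ b ∷ʳ a) (bumpIfAscent-< u b<a))))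
         (revisedTail-< (subst (RevisedTail _) single tail) b<a (subst (a ≤_) (+-comm _ 1) a≤M+1))
... | u , single , pair | no  b≮a =
  subst₂ RevisedTail (sym (asctop-≮ p b≮a)) (sym (trans (pair a) (cong (λ w → w ∷ʳ b ∷ʳ a) (bumpIfAscent-≮ u b≮a))))
         (revisedTail-≮ (subst (RevisedTail _) single tail) 1≤a (≮⇒≥ b≮a))

ascentSeq⇒revisedTail : ∀ {x} → Reverse x → IsAscentSeq x → RevisedTail (asctop x) (ηTail x)
ascentSeq⇒revisedTail []               (_ , () , _)
ascentSeq⇒revisedTail (.[] ∶ [] ∶ʳ c)  (_ , refl , _) = revisedTail-[1]
ascentSeq⇒revisedTail (.(p ∷ʳ b) ∶ rx@(p ∶ _ ∶ʳ b) ∶ʳ a) asc =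
  let (ascx , 1≤a , a≤M+1) = to (IsAscentSeq-∷ʳ (p ∷ʳ b) a (1≤length-∷ʳ p b)) asc
  in revisedTail-step p b a (ascentSeq⇒revisedTail rx ascx) 1≤a a≤M+1

η-IsRevised : ∀ x → IsAscentSeq x → IsRevised (η x)
η-IsRevised []      (_ , () , _)
η-IsRevised (c ∷ x) asc with ηTail (c ∷ x) in ηx≡ | length-ηTail (c ∷ x)
... | b ∷ y | ∣by∣≡∣cx∣ =
  subst (λ t → IsRevised (t ∷ b ∷ y)) (sym (revisedTail-max tail)) (revisedTail⇒IsRevised tail asctop≤)
  where
  tail : RevisedTail (asctop (c ∷ x)) (b ∷ y)
  tail = subst (RevisedTail _) ηx≡ (ascentSeq⇒revisedTail (reverseView (c ∷ x)) asc)
  asctop≤ : asctop (c ∷ x) ≤ length (asctop (c ∷ x) ∷ b ∷ y)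
  asctop≤ = ≤-trans (asctop≤length c x) (≤-trans (≤-reflexive (sym ∣by∣≡∣cx∣)) (n≤1+n _))

bumpIfAscent-injective : ∀ b a {u u′} → bumpIfAscent b a u ≡ bumpIfAscent b a u′ → u ≡ u′
bumpIfAscent-injective b a with b <ᵇ a
... | true  = map-injective (BumpEmbedding.f-injective b)
... | false = id

ηTail-injective-∷ʳ : ∀ p b a p′ b′ a′ → (ηTail (p ∷ʳ b) ≡ ηTail (p′ ∷ʳ b′) → p ∷ʳ b ≡ p′ ∷ʳ b′) →
                     ηTail (p ∷ʳ b ∷ʳ a) ≡ ηTail (p′ ∷ʳ b′ ∷ʳ a′) → p ∷ʳ b ∷ʳ a ≡ p′ ∷ʳ b′ ∷ʳ a′
ηTail-injective-∷ʳ p b a p′ b′ a′ injective-init ηx≡ηy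
  with ηTail-∷ʳ p b | ηTail-∷ʳ p′ b′
... | u , single , pair | u′ , single′ , pair′
  with ∷ʳ-injective _ _ (trans (sym (pair a)) (trans ηx≡ηy (pair′ a′)))
... | init≡ , refl with ∷ʳ-injective _ _ init≡
... | bumped≡ , refl =
  cong (_∷ʳ a) (injective-init (trans single (trans (cong (_∷ʳ b) (bumpIfAscent-injective b a bumped≡))
                                                    (sym single′))))

ηTail-injective : ∀ {x y} → Reverse x → Reverse y → length x ≡ length y → ηTail x ≡ ηTail y → x ≡ y
ηTail-injective [] [] _ _ = refl
ηTail-injective [] (ys ∶ _ ∶ʳ a) ∣x∣≡∣y∣ _ = contradiction (trans ∣x∣≡∣y∣ (length-∷ʳ ys a)) 0≢1+n
ηTail-injective (xs ∶ _ ∶ʳ a) [] ∣x∣≡∣y∣ _ = contradiction (trans (sym ∣x∣≡∣y∣) (length-∷ʳ xs a)) 0≢1+n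
ηTail-injective (.[] ∶ [] ∶ʳ a) (.[] ∶ [] ∶ʳ a′) _ ηx≡ηy = ηx≡ηy
ηTail-injective (.[] ∶ [] ∶ʳ a) (.(q ∷ʳ b′) ∶ (q ∶ _ ∶ʳ b′) ∶ʳ a′) ∣x∣≡∣y∣ _ =
  contradiction (suc-injective (trans ∣x∣≡∣y∣ (length-∷ʳ-∷ʳ q b′ a′))) 0≢1+n
ηTail-injective (.(p ∷ʳ b) ∶ (p ∶ _ ∶ʳ b) ∶ʳ a) (.[] ∶ [] ∶ʳ a′) ∣x∣≡∣y∣ _ =
  contradiction (suc-injective (trans (sym ∣x∣≡∣y∣) (length-∷ʳ-∷ʳ p b a))) 0≢1+n
ηTail-injective (.(p ∷ʳ b) ∶ rx@(p ∶ _ ∶ʳ b) ∶ʳ a) (.(p′ ∷ʳ b′) ∶ ry@(p′ ∶ _ ∶ʳ b′) ∶ʳ a′) ∣x∣≡∣y∣ =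
  ηTail-injective-∷ʳ p b a p′ b′ a′ (ηTail-injective rx ry ∣xb∣≡∣yb∣)
  where
  ∣xb∣≡∣yb∣ : length (p ∷ʳ b) ≡ length (p′ ∷ʳ b′)
  ∣xb∣≡∣yb∣ = suc-injective (trans (sym (length-∷ʳ (p ∷ʳ b) a)) (trans ∣x∣≡∣y∣ (length-∷ʳ (p′ ∷ʳ b′) a′)))

ascentSeq-extend : ∀ {x q b} a → IsAscentSeq x → ηTail x ≡ q ∷ʳ b → 1 ≤ a → a ≤ asctop x + 1 →
                   IsAscentSeq (x ∷ʳ a) × ηTail (x ∷ʳ a) ≡ bumpIfAscent b a q ∷ʳ b ∷ʳ a
                 × (b < a → asctop (x ∷ʳ a) ≡ suc (asctop x)) × (¬ b < a → asctop (x ∷ʳ a) ≡ asctop x)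
ascentSeq-extend {x} {b = b} a asc ηx≡ 1≤a a≤top+1 with ηTail-last x ηx≡
... | p , refl = from (IsAscentSeq-∷ʳ (p ∷ʳ b) a (1≤length-∷ʳ p b)) (asc , 1≤a , a≤top+1)
               , ηTail-extend (p ∷ʳ b) a ηx≡ , asctop-< p , asctop-≮ p

revisedTail⇒ascentSeq : ∀ n r {M} → length r ≡ suc n → RevisedTail M r →
                        ∃ λ x → IsAscentSeq x × asctop x ≡ M × ηTail x ≡ r
revisedTail⇒ascentSeq zero (c ∷ []) _ tail =
  let (M≡1 , c≡1) = revisedTail-singleton tail in [ 1 ] , IsAscentSeq-[1] , sym M≡1 , cong [_] (sym c≡1)
revisedTail⇒ascentSeq (suc n) r {M} ∣r∣≡n+2 tail with initLast r
... | [] = contradiction ∣r∣≡n+2 0≢1+n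
... | r′ ∷ʳ′ a with initLast r′
...   | [] = contradiction (suc-injective ∣r∣≡n+2) 0≢1+n
...   | p ∷ʳ′ b = preimage (b <? a)
  where
  1≤a = proj₁ (to (proj₂ tail a) (there (∈-++⁺ʳ (p ∷ʳ b) (here refl))))
  a≤M = proj₂ (to (proj₂ tail a) (there (∈-++⁺ʳ (p ∷ʳ b) (here refl))))
  ∣pb∣≡n+1 : length (p ∷ʳ b) ≡ suc n
  ∣pb∣≡n+1 = suc-injective (trans (sym (length-∷ʳ (p ∷ʳ b) a)) ∣r∣≡n+2)
  preimage : Dec (b < a) → ∃ λ x → IsAscentSeq x × asctop x ≡ M × ηTail x ≡ p ∷ʳ b ∷ʳ a
  preimage (no b≮a) =
    let (x , asc , top , ηx≡) = revisedTail⇒ascentSeq n (p ∷ʳ b) ∣pb∣≡n+1 (revisedTail-≮⁻¹ tail b≮a)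
        (asc⁺ , ηx⁺≡ , _ , top⁺) =
          ascentSeq-extend a asc ηx≡ 1≤a (≤-trans a≤M (≤-trans (≤-reflexive (sym top)) (m≤m+n _ 1)))
    in x ∷ʳ a , asc⁺ , trans (top⁺ b≮a) top , trans ηx⁺≡ (cong (λ w → w ∷ʳ b ∷ʳ a) (bumpIfAscent-≮ p b≮a))
  preimage (yes b<a) =
    let (x , asc , top , ηx≡) = revisedTail⇒ascentSeq n (map (unbump b) p ∷ʳ b) ∣p⁻b∣≡n+1 tail⁻
        (asc⁺ , ηx⁺≡ , top⁺ , _) =
          ascentSeq-extend a asc ηx≡ 1≤a
            (≤-trans a≤M (≤-reflexive (trans (sym M≡) (trans (cong suc (sym top)) (+-comm 1 _)))))
    in x ∷ʳ a , asc⁺ , trans (top⁺ b<a) (trans (cong suc top) M≡)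
     , trans ηx⁺≡ (cong (λ w → w ∷ʳ b ∷ʳ a) (trans (bumpIfAscent-< _ b<a) bump-p⁻))
    where
    M≡ : suc (pred M) ≡ M
    M≡ = suc-pred M {{>-nonZero (≤-trans 1≤a a≤M)}}
    unbumped = revisedTail-<⁻¹ (subst (λ t → RevisedTail t (p ∷ʳ b ∷ʳ a)) (sym M≡) tail) b<a
    tail⁻ = proj₁ unbumped
    bump-p⁻ = proj₂ unbumped
    ∣p⁻b∣≡n+1 : length (map (unbump b) p ∷ʳ b) ≡ suc n
    ∣p⁻b∣≡n+1 = trans (length-∷ʳ (map (unbump b) p) b)
                      (trans (cong suc (length-map (unbump b) p)) (trans (sym (length-∷ʳ p b)) ∣pb∣≡n+1))

η-surjective : ∀ n z → IsRevised z → length z ≡ suc (suc n) →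
               ∃ λ x → IsAscentSeq x × length x ≡ suc n × η x ≡ z
η-surjective n (c ∷ b ∷ y) rev ∣z∣≡n+2 =
  let tail = IsRevised⇒revisedTail rev
      (x , asc , _ , ηx≡) = revisedTail⇒ascentSeq n (b ∷ y) (suc-injective ∣z∣≡n+2) tail
  in x , asc , trans (sym (length-ηTail x)) (trans (cong length ηx≡) (suc-injective ∣z∣≡n+2))
   , cong₂ _∷_ (trans (cong maxW ηx≡) (revisedTail-max tail)) ηx≡

mainTheorem1 : ∀ (n : ℕ) → 1 ≤ n →
      (∀ x → IsAscentSeq x → length x ≡ n →
         IsRevised (η x) × (length (η x) ≡ suc n))
    × (∀ x y → IsAscentSeq x → length x ≡ n → IsAscentSeq y → length y ≡ n →
         η x ≡ η y → x ≡ y)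
    × (∀ z → IsRevised z → length z ≡ suc n →
         Σ (List ℕ) (λ x → IsAscentSeq x × (length x ≡ n) × (η x ≡ z)))
mainTheorem1 (suc n) _ =
    (λ x asc ∣x∣≡n → η-IsRevised x asc , cong suc (trans (length-ηTail x) ∣x∣≡n))
  , (λ x y _ ∣x∣≡n _ ∣y∣≡n ηx≡ηy →
       ηTail-injective (reverseView x) (reverseView y) (trans ∣x∣≡n (sym ∣y∣≡n)) (proj₂ (∷-injective ηx≡ηy)))
  , η-surjective n
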